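{- The axiomatic system $\mathit{AX}(\mathcal{L}_{\mathsf{C}})$ is sound and complete for the validities of $\mathcal{L}_{\mathsf{C}}$: for every formula $\varphi$ of $\mathcal{L}_{\mathsf{C}}$, $\vdash_{\mathsf{C}}\varphi$ iff $\varphi$ is valid.
   Context: Fix a countably infinite set $\mathit{PROP}$ of proposition symbols; assignments are maps $w:\mathit{PROP}\to\{0,1\}$; an SD-model is a (possibly empty) set $W$ of assignments. $\mathcal{L}_{\mathsf{C}}$: formulae $\varphi::=p\mid\neg\varphi\mid(\varphi\to\varphi)\mid\mathsf{C}\varphi$, $p\in\mathit{PROP}$; $\wedge,\vee,\leftrightarrow$ usual abbreviations, $\top:=p\vee\neg p$. Semantics at $w\in W$: $W,w\models p$ iff $w(p)=1$; $\neg,\to$ classical; $W,w\models\mathsf{C}\varphi$ iff for all $u,v\in W$, $W,u\models\varphi\Leftrightarrow W,v\models\varphi$. $\varphi$ is valid if $W,w\models\varphi$ for every SD-model $W$ and every $w\in W$. $\mathit{AX}(\mathcal{L}_{\mathsf{C}})$ (derivability $\vdash_{\mathsf{C}}$): axiom schemata: a complete set of axioms for classical propositional logic; $\mathsf{C}\top$; $\mathsf{C}\varphi\leftrightarrow\mathsf{C}\neg\varphi$; $\mathsf{C}(\varphi\wedge\mathsf{C}\varphi)$; $\mathsf{C}\varphi\wedge\mathsf{C}\psi\to\mathsf{C}(\varphi\wedge\psi)$; $\varphi\wedge\mathsf{C}\varphi\wedge\mathsf{C}(\varphi\to\psi)\to\mathsf{C}\psi$. Rules: Modus Ponens; if $\vdash\varphi\leftrightarrow\psi$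 then $\vdash\mathsf{C}\varphi\leftrightarrow\mathsf{C}\psi$. -}

module Defs where

open import Data.Nat using (ℕ)
open import Data.Bool using (Bool; true)
open import Data.Product using (_×_)
open import Relation.Nullary using (¬_)
open import Relation.Binary.PropositionalEquality using (_≡_)
open import Relation.Unary using (Pred; _∈_)
open import Level using (0ℓ)

PROP : Set
PROP = ℕ

-- Assignments w : PROP → {0,1}, with {0,1} rendered as Bool (1 = true).
Assignment : Set
Assignment = PROP → Bool

-- An SD-model: a (possibly empty, possibly infinite) set of assignments.
SDModel : Set₁
SDModel = Pred Assignment 0ℓ

infixr 5 _⇒_
data Form : Set where
  var : PROP → Form
  ¬'  : Form → Form
  _⇒_ : Form → Form → Form
  C   : Form → Form

_∧'_ : Form → Form → Form
φ ∧' ψ = ¬' (φ ⇒ ¬' ψ)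

_∨'_ : Form → Form → Form
φ ∨' ψ = ¬' φ ⇒ ψ

_⇔'_ : Form → Form → Form
φ ⇔' ψ = (φ ⇒ ψ) ∧' (ψ ⇒ φ)

⊤' : Form
⊤' = var 0 ∨' ¬' (var 0)

_↔_ : Set → Set → Set
A ↔ B = (A → B) × (B → A)

-- Satisfaction W, w ⊨ φ (w is assumed to be a member of W where needed).
infix 4 _,_⊨_
_,_⊨_ : SDModel → Assignment → Form → Set
W , w ⊨ var p   = w p ≡ true
W , w ⊨ ¬' φ    = ¬ (W , w ⊨ φ)
W , w ⊨ (φ ⇒ ψ) = W , w ⊨ φ → W , w ⊨ ψ
W , w ⊨ C φ     = ∀ u v → u ∈ W → v ∈ W → (W , u ⊨ φ) ↔ (W , v ⊨ φ)

Valid : Form → Set₁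
Valid φ = (W : SDModel) → (w : Assignment) → w ∈ W → W , w ⊨ φ

-- The axiom system AX(L_C).  Classical propositional logic is axiomatised
-- by the Łukasiewicz axioms (A1–A3) for ¬, → together with Modus Ponens.
infix 3 ⊢_
data ⊢_ : Form → Set where
  ax1   : ∀ {φ ψ} → ⊢ φ ⇒ (ψ ⇒ φ)
  ax2   : ∀ {φ ψ χ} → ⊢ (φ ⇒ (ψ ⇒ χ)) ⇒ ((φ ⇒ ψ) ⇒ (φ ⇒ χ))
  ax3   : ∀ {φ ψ} → ⊢ (¬' φ ⇒ ¬' ψ) ⇒ (ψ ⇒ φ)
  cTop  : ⊢ C ⊤'
  cNeg  : ∀ {φ} → ⊢ C φ ⇔' C (¬' φ)
  cSelf : ∀ {φ} → ⊢ C (φ ∧' C φ)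
  cAnd  : ∀ {φ ψ} → ⊢ (C φ ∧' C ψ) ⇒ C (φ ∧' ψ)
  cImp  : ∀ {φ ψ} → ⊢ ((φ ∧' C φ) ∧' C (φ ⇒ ψ)) ⇒ C ψ
  mp    : ∀ {φ ψ} → ⊢ φ → ⊢ φ ⇒ ψ → ⊢ ψ
  re    : ∀ {φ ψ} → ⊢ φ ⇔' ψ → ⊢ C φ ⇔' C ψ

module Submission where

-- Soundness is a check of each axiom, using that satisfaction is stable
-- under double negation.  For completeness, treat the formulae C α as
-- propositional atoms.  By Kalmár's argument it suffices to derive φ from
-- the literals that an arbitrary valuation b of the atoms of φ makes true.
-- Given b, take the SD-model of all assignments that agree with b on the
-- bodies α of those atoms C α that b makes true.  If b makes some C ψ false
-- although ψ is constant on this model, the literals are inconsistent: they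
-- prove the conjunction Θ of the formulae ±α ∧ C α and ¬ C α recording b,
-- which is provably C-constant and propositionally implies ±ψ, so the axiom
-- for C and → yields C ψ.  Otherwise a formula holds at a point of the model
-- exactly when b and that point make it true, so the validity of φ makes b
-- satisfy φ and Kalmár's lemma derives it.  Constancy is decidable because
-- only finitely many variables matter.

open import Defs
open import Data.Bool using (Bool; true; false; not; _∨_; if_then_else_)
open import Data.Bool.Properties using (not-injective; ¬-not) renaming (_≟_ to _≟ᵇ_)
open import Data.Empty using (⊥-elim)
open import Data.Fin as Fin using (Fin)
open import Data.Fin.Subset.Properties using (anySubset?)
open import Data.List as List using (List; []; _∷_; _++_)
open import Data.List.Membership.Propositional using (_∈_; find; lose)
open import Data.List.Membership.Propositional.Properties using (∈-++⁺ˡ; ∈-++⁺ʳ; ∈-++⁻; ∈-map⁺; ∈-map⁻)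
open import Data.List.Relation.Binary.Subset.Propositional using (_⊆_)
open import Data.List.Relation.Binary.Subset.Propositional.Properties using (xs⊆xs++ys; ++⁺ˡ)
open import Data.List.Relation.Unary.All as All using ()
open import Data.List.Relation.Unary.Any using (here; there; any?; tail)
open import Data.Nat using (ℕ; zero; suc; _<_; _⊔_; s≤s)
open import Data.Nat.Properties using (n<1+n; <-≤-trans; m≤m⊔n; m≤n⊔m) renaming (_≟_ to _≟ℕ_)
open import Data.Product using (_×_; _,_; proj₁; proj₂; ∃-syntax)
open import Data.Sum using (_⊎_; inj₁; inj₂)
open import Data.Vec as Vec using (Vec; []; _∷_; lookup)
open import Data.Vec.Properties using (lookup-map)
open import Function using (case_of_)
open import Level using (Level)
open import Relation.Binary.Definitions using (DecidableEquality)
open import Relation.Binary.PropositionalEquality using (_≡_; refl; sym; trans; cong; cong₂; subst)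
open import Relation.Nullary using (¬_; Dec; yes; no; does; ¬?)
open import Relation.Nullary.Decidable using (True; toWitness; map′; _×-dec_; _→-dec_; decidable-stable)
open import Relation.Nullary.Reflects using (Reflects; ofʸ; ofⁿ; ¬-reflects; _→-reflects_; det)
open import Relation.Unary using (Pred; Decidable)

private
  variable
    ℓ : Level
    n p : ℕ
    φ ψ χ α : Form
    Γ Δ : List Form
    X Y : Set

infix 4 _≟_
_≟_ : DecidableEquality Form
var p   ≟ var q     = map′ (cong var) (λ { refl → refl }) (p ≟ℕ q)
¬' φ    ≟ ¬' ψ      = map′ (cong ¬') (λ { refl → refl }) (φ ≟ ψ)
(φ ⇒ ψ) ≟ (φ′ ⇒ ψ′) = map′ (λ { (refl , refl) → refl }) (λ { refl → refl , refl }) (φ ≟ φ′ ×-dec ψ ≟ ψ′)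
C φ     ≟ C ψ       = map′ (cong C) (λ { refl → refl }) (φ ≟ ψ)
var _   ≟ ¬' _      = no λ ()
var _   ≟ _ ⇒ _     = no λ ()
var _   ≟ C _       = no λ ()
¬' _    ≟ var _     = no λ ()
¬' _    ≟ _ ⇒ _     = no λ ()
¬' _    ≟ C _       = no λ ()
(_ ⇒ _) ≟ var _     = no λ ()
(_ ⇒ _) ≟ ¬' _      = no λ ()
(_ ⇒ _) ≟ C _       = no λ ()
C _     ≟ var _     = no λ ()
C _     ≟ ¬' _      = no λ ()
C _     ≟ _ ⇒ _     = no λ ()

atoms : Form → List Form
atoms (var p) = var p ∷ []
atoms (¬' φ)  = atoms φ
atoms (φ ⇒ ψ) = atoms φ ++ atoms ψ
atoms (C φ)   = C φ ∷ atoms φ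

boxes : Form → List Form
boxes (var p) = []
boxes (¬' φ)  = boxes φ
boxes (φ ⇒ ψ) = boxes φ ++ boxes ψ
boxes (C φ)   = φ ∷ boxes φ

bound : Form → ℕ
bound (var p) = suc p
bound (¬' φ)  = bound φ
bound (φ ⇒ ψ) = bound φ ⊔ bound ψ
bound (C φ)   = bound φ

var∈atoms⇒<bound : ∀ φ → var p ∈ atoms φ → p < bound φ
var∈atoms⇒<bound (var p) (here refl) = n<1+n p
var∈atoms⇒<bound (¬' φ) m = var∈atoms⇒<bound φ m
var∈atoms⇒<bound (φ ⇒ ψ) m with ∈-++⁻ (atoms φ) m
... | inj₁ m₁ = <-≤-trans (var∈atoms⇒<bound φ m₁) (m≤m⊔n _ _)
... | inj₂ m₂ = <-≤-trans (var∈atoms⇒<bound ψ m₂) (m≤n⊔m _ _)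
var∈atoms⇒<bound (C φ) (there m) = var∈atoms⇒<bound φ m

∈boxes⇒atoms⊆ : ∀ φ → α ∈ boxes φ → atoms (C α) ⊆ atoms φ
∈boxes⇒atoms⊆ (¬' φ) m = ∈boxes⇒atoms⊆ φ m
∈boxes⇒atoms⊆ (φ ⇒ ψ) m with ∈-++⁻ (boxes φ) m
... | inj₁ m₁ = λ a → ∈-++⁺ˡ (∈boxes⇒atoms⊆ φ m₁ a)
... | inj₂ m₂ = λ a → ∈-++⁺ʳ (atoms φ) (∈boxes⇒atoms⊆ ψ m₂ a)
∈boxes⇒atoms⊆ (C φ) (here refl) = λ a → a
∈boxes⇒atoms⊆ (C φ) (there m) = λ a → there (∈boxes⇒atoms⊆ φ m a)

∈boxes⇒boxes⊆ : ∀ φ → α ∈ boxes φ → boxes α ⊆ boxes φ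
∈boxes⇒boxes⊆ (¬' φ) m = ∈boxes⇒boxes⊆ φ m
∈boxes⇒boxes⊆ (φ ⇒ ψ) m with ∈-++⁻ (boxes φ) m
... | inj₁ m₁ = λ a → ∈-++⁺ˡ (∈boxes⇒boxes⊆ φ m₁ a)
... | inj₂ m₂ = λ a → ∈-++⁺ʳ (boxes φ) (∈boxes⇒boxes⊆ ψ m₂ a)
∈boxes⇒boxes⊆ (C φ) (here refl) = there
∈boxes⇒boxes⊆ (C φ) (there m) = λ a → there (∈boxes⇒boxes⊆ φ m a)

-- Boolean semantics, with the formulae C α as atoms

eval : Assignment → (Form → Bool) → Form → Bool
eval u c (var p) = u p
eval u c (¬' φ)  = not (eval u c φ)
eval u c (φ ⇒ ψ) = not (eval u c φ) ∨ eval u c ψ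
eval u c (C φ)   = c φ

eval-cong : ∀ χ {u u′ c c′} →
            (∀ {p} → var p ∈ atoms χ → u p ≡ u′ p) → (∀ {β} → β ∈ boxes χ → c β ≡ c′ β) →
            eval u c χ ≡ eval u′ c′ χ
eval-cong (var p) eu ec = eu (here refl)
eval-cong (¬' χ) eu ec = cong not (eval-cong χ eu ec)
eval-cong (χ ⇒ ψ) eu ec =
  cong₂ (λ x y → not x ∨ y)
        (eval-cong χ (λ m → eu (∈-++⁺ˡ m)) (λ m → ec (∈-++⁺ˡ m)))
        (eval-cong ψ (λ m → eu (∈-++⁺ʳ (atoms χ) m)) (λ m → ec (∈-++⁺ʳ (boxes χ) m)))
eval-cong (C χ) eu ec = ec (here refl)

Valuation : Set
Valuation = Form → Bool

value : Valuation → Form → Bool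
value b = eval (λ p → b (var p)) (λ α → b (C α))

Tautology : Form → Set
Tautology φ = ∀ b → value b φ ≡ true

signed : Bool → Form → Form
signed v φ = if v then φ else ¬' φ

value-signed : ∀ b v → (value b (signed v φ) ≡ true) ↔ (value b φ ≡ v)
value-signed b true  = (λ e → e) , (λ e → e)
value-signed b false = not-injective , cong not

value-∧ : ∀ b φ ψ → value b (φ ∧' ψ) ≡ true → value b φ ≡ true × value b ψ ≡ true
value-∧ b φ ψ e with value b φ | value b ψ
... | true | true = refl , refl

infix 3 _⊢_
data _⊢_ (Γ : List Form) : Form → Set where
  hyp : φ ∈ Γ → Γ ⊢ φ
  thm : ⊢ φ → Γ ⊢ φ
  mp  : Γ ⊢ φ → Γ ⊢ φ ⇒ ψ → Γ ⊢ ψ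

assumption : φ ∷ Γ ⊢ φ
assumption = hyp (here refl)

weaken : Γ ⊆ Δ → Γ ⊢ φ → Δ ⊢ φ
weaken s (hyp m)  = hyp (s m)
weaken s (thm d)  = thm d
weaken s (mp d e) = mp (weaken s d) (weaken s e)

⇒-refl : ⊢ φ ⇒ φ
⇒-refl {φ} = mp (ax1 {φ} {φ}) (mp (ax1 {φ} {φ ⇒ φ}) ax2)

deduction : φ ∷ Γ ⊢ ψ → Γ ⊢ φ ⇒ ψ
deduction (hyp (here refl)) = thm ⇒-refl
deduction (hyp (there m))   = mp (hyp m) (thm ax1)
deduction (thm d)           = mp (thm d) (thm ax1)
deduction (mp d e)          = mp (deduction d) (mp (deduction e) (thm ax2))

closed : [] ⊢ φ → ⊢ φ
closed (thm d)  = d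
closed (mp d e) = mp (closed d) (closed e)

explosion : ⊢ ¬' φ ⇒ (φ ⇒ ψ)
explosion = closed (deduction (mp (mp assumption (thm ax1)) (thm ax3)))

¬¬-elim : ⊢ ¬' (¬' φ) ⇒ φ
¬¬-elim = closed (deduction (mp assumption (mp (mp assumption (thm explosion)) (thm ax3))))

¬¬-intro : ⊢ φ ⇒ ¬' (¬' φ)
¬¬-intro = mp ¬¬-elim ax3

contraposition : ⊢ (φ ⇒ ψ) ⇒ (¬' ψ ⇒ ¬' φ)
contraposition {φ} {ψ} = closed (deduction (mp (deduction ¬¬φ⊢¬¬ψ) (thm ax3)))
  where
  ¬¬φ⊢¬¬ψ : ¬' (¬' φ) ∷ (φ ⇒ ψ) ∷ [] ⊢ ¬' (¬' ψ)
  ¬¬φ⊢¬¬ψ = mp (mp (mp assumption (thm ¬¬-elim)) (hyp (there (here refl)))) (thm ¬¬-intro)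

¬⇒-intro : ⊢ φ ⇒ (¬' ψ ⇒ ¬' (φ ⇒ ψ))
¬⇒-intro =
  closed (deduction (mp (deduction (mp (hyp (there (here refl))) assumption)) (thm contraposition)))

by-cases : Γ ⊢ φ ⇒ ψ → Γ ⊢ ¬' φ ⇒ ψ → Γ ⊢ ψ
by-cases {Γ} {φ} {ψ} d e = mp (thm ⇒-refl) (mp (deduction ¬ψ⊢⊥) (thm ax3))
  where
  ¬ψ⊢⊥ : ¬' ψ ∷ Γ ⊢ ¬' (ψ ⇒ ψ)
  ¬ψ⊢⊥ = mp (mp assumption (mp (weaken there d) (thm contraposition)))
            (mp (mp assumption (mp (weaken there e) (thm contraposition))) (thm explosion))

-- Kalmár's lemma

literals : Valuation → List Form → List Form
literals b = List.map (λ a → signed (b a) a)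

kalmar : ∀ {b A} χ → atoms χ ⊆ A → literals b A ⊢ signed (value b χ) χ
kalmar (var p) s = hyp (∈-map⁺ _ (s (here refl)))
kalmar (C χ)   s = hyp (∈-map⁺ _ (s (here refl)))
kalmar {b} (¬' χ) s with value b χ | kalmar {b} χ s
... | true  | d = mp d (thm ¬¬-intro)
... | false | d = d
kalmar {b} (χ ⇒ ψ) s
  with value b χ | value b ψ
     | kalmar {b} χ (λ m → s (∈-++⁺ˡ m)) | kalmar {b} ψ (λ m → s (∈-++⁺ʳ (atoms χ) m))
... | true  | true  | _  | dψ = mp dψ (thm ax1)
... | true  | false | dχ | dψ = mp dψ (mp dχ (thm ¬⇒-intro))
... | false | _     | dχ | _  = mp dχ (thm explosion)

_[_≔_] : Valuation → Form → Bool → Valuation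
(b [ a ≔ v ]) x = if does (x ≟ a) then v else b x

literals-update : ∀ b a v A → literals (b [ a ≔ v ]) (a ∷ A) ⊆ signed v a ∷ literals b A
literals-update b a v A m with ∈-map⁻ _ m
... | x , x∈ , refl with x ≟ a
...   | yes refl = here refl
...   | no x≢a   = there (∈-map⁺ _ (tail x≢a x∈))

eliminate : ∀ A → (∀ b → literals b A ++ Γ ⊢ φ) → Γ ⊢ φ
eliminate []      H = H (λ _ → true)
eliminate {Γ} {φ} (a ∷ A) H =
  eliminate A λ b → by-cases (deduction (branch b true)) (deduction (branch b false))
  where
  branch : ∀ b v → signed v a ∷ literals b A ++ Γ ⊢ φ
  branch b v = weaken (++⁺ˡ Γ (literals-update b a v A)) (H (b [ a ≔ v ]))

literals-elimination : ∀ A → (∀ b → literals b A ⊢ φ) → ⊢ φ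
literals-elimination A H = closed (eliminate A λ b → weaken (xs⊆xs++ys _ _) (H b))

tautology⇒theorem : Tautology φ → ⊢ φ
tautology⇒theorem {φ} T = literals-elimination (atoms φ) λ b →
  subst (λ v → literals b (atoms φ) ⊢ signed v φ) (T b) (kalmar φ (λ m → m))

∀-valuation? : {P : Pred (Vec Bool n) ℓ} → Decidable P → Dec (∀ ρ → P ρ)
∀-valuation? P? =
  map′ (λ ∄ρ ρ → decidable-stable (P? ρ) (λ ¬Pρ → ∄ρ (ρ , ¬Pρ)))
       (λ ∀ρ (ρ , ¬Pρ) → ¬Pρ (∀ρ ρ))
       (¬? (anySubset? (λ ρ → ¬? (P? ρ))))

infix 4 _≈[_]_
_≈[_]_ : Assignment → ℕ → Assignment → Set
u ≈[ n ] v = ∀ {p} → p < n → u p ≡ v p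

restrict : ∀ n → Assignment → Vec Bool n
restrict zero    u = []
restrict (suc n) u = u 0 ∷ restrict n (λ p → u (suc p))

extend : Vec Bool n → Assignment
extend []      _       = false
extend (x ∷ ρ) zero    = x
extend (x ∷ ρ) (suc p) = extend ρ p

extend-restrict : ∀ n u → extend (restrict n u) ≈[ n ] u
extend-restrict (suc n) u {zero}  _         = refl
extend-restrict (suc n) u {suc p} (s≤s p<n) = extend-restrict n (λ p → u (suc p)) p<n

∀-assignment? : ∀ n {P : Pred Assignment ℓ} → Decidable P → (∀ {u v} → u ≈[ n ] v → P u → P v) →
                Dec (∀ u → P u)
∀-assignment? n P? invariant =
  map′ (λ ∀ρ u → invariant (extend-restrict n u) (∀ρ (restrict n u))) (λ ∀u ρ → ∀u (extend ρ))
       (∀-valuation? (λ ρ → P? (extend ρ)))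

infix  7 ~_
infixr 6 _∧ₛ_
infixr 5 _∨ₛ_ _⊃_
infix  4 _⇔ₛ_

data Schema (n : ℕ) : Set where
  atom : Fin n → Schema n
  ~_   : Schema n → Schema n
  _⊃_  : Schema n → Schema n → Schema n

_∧ₛ_ _∨ₛ_ _⇔ₛ_ : Schema n → Schema n → Schema n
S ∧ₛ T = ~ (S ⊃ ~ T)
S ∨ₛ T = ~ S ⊃ T
S ⇔ₛ T = (S ⊃ T) ∧ₛ (T ⊃ S)

p₀ : Schema (suc n)
p₀ = atom Fin.zero

p₁ : Schema (suc (suc n))
p₁ = atom (Fin.suc Fin.zero)

p₂ : Schema (suc (suc (suc n)))
p₂ = atom (Fin.suc (Fin.suc Fin.zero))

⟦_⟧ : Schema n → Vec Bool n → Bool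
⟦ atom i ⟧ ρ = lookup ρ i
⟦ ~ S ⟧    ρ = not (⟦ S ⟧ ρ)
⟦ S ⊃ T ⟧  ρ = not (⟦ S ⟧ ρ) ∨ ⟦ T ⟧ ρ

_⟨_⟩ : Schema n → Vec Form n → Form
atom i  ⟨ σ ⟩ = lookup σ i
(~ S)   ⟨ σ ⟩ = ¬' (S ⟨ σ ⟩)
(S ⊃ T) ⟨ σ ⟩ = S ⟨ σ ⟩ ⇒ T ⟨ σ ⟩

value-instance : ∀ b (S : Schema n) σ → value b (S ⟨ σ ⟩) ≡ ⟦ S ⟧ (Vec.map (value b) σ)
value-instance b (atom i) σ = sym (lookup-map i (value b) σ)
value-instance b (~ S)    σ = cong not (value-instance b S σ)
value-instance b (S ⊃ T)  σ = cong₂ (λ x y → not x ∨ y) (value-instance b S σ) (value-instance b T σ)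

tautologous? : (S : Schema n) → Dec (∀ ρ → ⟦ S ⟧ ρ ≡ true)
tautologous? S = ∀-valuation? (λ ρ → ⟦ S ⟧ ρ ≟ᵇ true)

-- The side condition is checked by evaluating the truth table.
tautology : (S : Schema n) (σ : Vec Form n) {_ : True (tautologous? S)} → ⊢ S ⟨ σ ⟩
tautology S σ {valid} = tautology⇒theorem λ b →
  trans (value-instance b S σ) (toWitness valid (Vec.map (value b) σ))

∧-intro : Γ ⊢ φ → Γ ⊢ ψ → Γ ⊢ φ ∧' ψ
∧-intro {φ = φ} {ψ} d e = mp e (mp d (thm (tautology (p₀ ⊃ p₁ ⊃ p₀ ∧ₛ p₁) (φ ∷ ψ ∷ []))))

⊤-intro : Γ ⊢ ⊤'
⊤-intro = thm (tautology (p₀ ∨ₛ ~ p₀) (var 0 ∷ []))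

⇔-elimʳ : ⊢ φ ⇔' ψ → ⊢ ψ ⇒ φ
⇔-elimʳ {φ} {ψ} d = mp d (tautology ((p₀ ⇔ₛ p₁) ⊃ p₁ ⊃ p₀) (φ ∷ ψ ∷ []))

C-cong : ⊢ φ ⇔' ψ → ⊢ C φ → ⊢ C ψ
C-cong {φ} {ψ} d c = mp c (mp (re d) (tautology ((p₀ ⇔ₛ p₁) ⊃ p₀ ⊃ p₁) (C φ ∷ C ψ ∷ [])))

necessitation : ⊢ φ → ⊢ C φ
necessitation {φ} d = C-cong (mp d (tautology (p₀ ⊃ (p₁ ∨ₛ ~ p₁ ⇔ₛ p₀)) (φ ∷ var 0 ∷ []))) cTop

C-¬ : ⊢ C φ → ⊢ C (¬' φ)
C-¬ {φ} c = mp c (mp cNeg (tautology ((p₀ ⇔ₛ p₁) ⊃ p₀ ⊃ p₁) (C φ ∷ C (¬' φ) ∷ [])))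

C-∧ : ⊢ C φ → ⊢ C ψ → ⊢ C (φ ∧' ψ)
C-∧ c d = mp (closed (∧-intro (thm c) (thm d))) cAnd

C-∨ : ⊢ C φ → ⊢ C ψ → ⊢ C (φ ∨' ψ)
C-∨ {φ} {ψ} c d =
  C-cong (tautology (~ (~ p₀ ∧ₛ ~ p₁) ⇔ₛ p₀ ∨ₛ p₁) (φ ∷ ψ ∷ [])) (C-¬ (C-∧ (C-¬ c) (C-¬ d)))

-- C φ holds exactly when one of the C-constant formulae φ ∧ C φ and
-- ¬ φ ∧ C ¬ φ does.
C-C : ⊢ C (C φ)
C-C {φ} =
  C-cong (mp cNeg (tautology ((p₁ ⇔ₛ p₂) ⊃ (p₀ ∧ₛ p₁ ∨ₛ ~ p₀ ∧ₛ p₂ ⇔ₛ p₁)) (φ ∷ C φ ∷ C (¬' φ) ∷ [])))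
         (C-∨ cSelf cSelf)

C-signed : ∀ v → ⊢ C (signed v φ ∧' C φ)
C-signed true  = cSelf
C-signed {φ} false =
  C-cong (mp cNeg (tautology ((p₁ ⇔ₛ p₂) ⊃ (~ p₀ ∧ₛ p₂ ⇔ₛ ~ p₀ ∧ₛ p₁)) (φ ∷ C φ ∷ C (¬' φ) ∷ []))) cSelf

C-unsigned : ∀ v → ⊢ C (signed v φ) ⇒ C φ
C-unsigned true  = ⇒-refl
C-unsigned false = ⇔-elimʳ cNeg

C-mp : ⊢ C φ → ⊢ C (φ ⇒ ψ) → ⊢ φ ⇒ C ψ
C-mp c d = closed (deduction (mp (∧-intro (∧-intro assumption (thm c)) (thm d)) (thm cImp)))

⋀ : (Form → Form) → List Form → Form
⋀ f []       = ⊤'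
⋀ f (x ∷ xs) = f x ∧' ⋀ f xs

C-⋀ : ∀ {f} xs → (∀ x → ⊢ C (f x)) → ⊢ C (⋀ f xs)
C-⋀ []       c = cTop
C-⋀ (x ∷ xs) c = C-∧ (c x) (C-⋀ xs c)

⋀-intro : ∀ {f} xs → (∀ {x} → x ∈ xs → Γ ⊢ f x) → Γ ⊢ ⋀ f xs
⋀-intro []       d = ⊤-intro
⋀-intro (x ∷ xs) d = ∧-intro (d (here refl)) (⋀-intro xs (λ m → d (there m)))

value-⋀ : ∀ b {f x} xs → value b (⋀ f xs) ≡ true → x ∈ xs → value b (f x) ≡ true
value-⋀ b {f} (x ∷ xs) t (here refl) = proj₁ (value-∧ b (f x) (⋀ f xs) t)
value-⋀ b {f} (x ∷ xs) t (there m)   = value-⋀ b xs (proj₂ (value-∧ b (f x) (⋀ f xs) t)) m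

-- Soundness

⊨-stable : ∀ {W w} φ → ¬ ¬ (W , w ⊨ φ) → W , w ⊨ φ
⊨-stable {w = w} (var p) ¬¬t with w p
... | true  = refl
... | false = ⊥-elim (¬¬t λ ())
⊨-stable (¬' φ)  ¬¬t t = ¬¬t λ ¬t → ¬t t
⊨-stable (φ ⇒ ψ) ¬¬t t = ⊨-stable ψ λ ¬u → ¬¬t λ f → ¬u (f t)
⊨-stable (C φ)   ¬¬t u v u∈ v∈ =
  (λ t → ⊨-stable φ λ ¬t → ¬¬t λ h → ¬t (proj₁ (h u v u∈ v∈) t)) ,
  (λ t → ⊨-stable φ λ ¬t → ¬¬t λ h → ¬t (proj₂ (h u v u∈ v∈) t))

⊨-∧⁺ : ∀ {W w} φ ψ → W , w ⊨ φ → W , w ⊨ ψ → W , w ⊨ φ ∧' ψ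
⊨-∧⁺ φ ψ t u f = f t u

⊨-∧⁻ : ∀ {W w} φ ψ → W , w ⊨ φ ∧' ψ → W , w ⊨ φ × W , w ⊨ ψ
⊨-∧⁻ φ ψ t = ⊨-stable φ (λ ¬u → t λ u → ⊥-elim (¬u u)) , ⊨-stable ψ (λ ¬u → t λ _ → ¬u)

↔-¬ : X ↔ Y → (¬ X) ↔ (¬ Y)
↔-¬ (f , g) = (λ ¬x y → ¬x (g y)) , (λ ¬y x → ¬y (f x))

⊨-↔-¬⁻ : ∀ {W u v} φ → (W , u ⊨ ¬' φ) ↔ (W , v ⊨ ¬' φ) → (W , u ⊨ φ) ↔ (W , v ⊨ φ)
⊨-↔-¬⁻ φ (f , g) = (λ t → ⊨-stable φ λ ¬t → g ¬t t) , (λ t → ⊨-stable φ λ ¬t → f ¬t t)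

⊨-C-intro : ∀ {W w} φ → (∀ u v → W u → W v → W , u ⊨ φ → W , v ⊨ φ) → W , w ⊨ C φ
⊨-C-intro φ f u v u∈ v∈ = f u v u∈ v∈ , f v u v∈ u∈

⊨-C-cong : ∀ {W w} φ ψ → (∀ u → W u → W , u ⊨ φ → W , u ⊨ ψ) → (∀ u → W u → W , u ⊨ ψ → W , u ⊨ φ) →
           W , w ⊨ C φ → W , w ⊨ C ψ
⊨-C-cong {W} {w} φ ψ f g c = ⊨-C-intro {W} {w} ψ λ u v u∈ v∈ t → f v v∈ (proj₁ (c u v u∈ v∈) (g u u∈ t))

soundness : ⊢ φ → Valid φ
soundness ax1 W w _ t _ = t
soundness ax2 W w _ f g t = f t (g t)
soundness (ax3 {φ}) W w _ h t = ⊨-stable φ λ ¬u → h ¬u t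
soundness cTop W w _ u v _ _ = (λ _ t → t) , (λ _ t → t)
soundness (cNeg {φ}) W w _ = ⊨-∧⁺ {W} {w} (C φ ⇒ C (¬' φ)) (C (¬' φ) ⇒ C φ)
  (λ h u v u∈ v∈ → ↔-¬ (h u v u∈ v∈))
  (λ h u v u∈ v∈ → ⊨-↔-¬⁻ φ (h u v u∈ v∈))
soundness (cSelf {φ}) W w _ = ⊨-C-intro {W} {w} (φ ∧' C φ) λ u v u∈ v∈ t →
  let (tφ , cφ) = ⊨-∧⁻ φ (C φ) t in ⊨-∧⁺ φ (C φ) (proj₁ (cφ u v u∈ v∈) tφ) cφ
soundness (cAnd {φ} {ψ}) W w _ t = ⊨-C-intro {W} {w} (φ ∧' ψ) λ u v u∈ v∈ t′ →
  let (cφ , cψ) = ⊨-∧⁻ {W} {w} (C φ) (C ψ) t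
      (tφ , tψ) = ⊨-∧⁻ φ ψ t′
  in ⊨-∧⁺ φ ψ (proj₁ (cφ u v u∈ v∈) tφ) (proj₁ (cψ u v u∈ v∈) tψ)
soundness (cImp {φ} {ψ}) W w w∈ t = ⊨-C-intro {W} {w} ψ λ u v u∈ v∈ tψ →
  let (φ∧Cφ , cφ⇒ψ) = ⊨-∧⁻ {W} {w} (φ ∧' C φ) (C (φ ⇒ ψ)) t
      (tφ , cφ) = ⊨-∧⁻ {W} {w} φ (C φ) φ∧Cφ
  in proj₁ (cφ⇒ψ u v u∈ v∈) (λ _ → tψ) (proj₁ (cφ w v w∈ v∈) tφ)
soundness (mp d e) W w w∈ = soundness e W w w∈ (soundness d W w w∈)
soundness (re {φ} {ψ} d) W w _ = ⊨-∧⁺ {W} {w} (C φ ⇒ C ψ) (C ψ ⇒ C φ)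
  (⊨-C-cong {W} {w} φ ψ to from) (⊨-C-cong {W} {w} ψ φ from to)
  where
  to : ∀ u → W u → W , u ⊨ φ → W , u ⊨ ψ
  to u u∈ = proj₁ (⊨-∧⁻ (φ ⇒ ψ) (ψ ⇒ φ) (soundness d W u u∈))
  from : ∀ u → W u → W , u ⊨ ψ → W , u ⊨ φ
  from u u∈ = proj₂ (⊨-∧⁻ (φ ⇒ ψ) (ψ ⇒ φ) (soundness d W u u∈))

-- Completeness

≡true-reflects : ∀ x → Reflects (x ≡ true) x
≡true-reflects true  = ofʸ refl
≡true-reflects false = ofⁿ λ ()

reflects-↔ : ∀ {x} → Reflects X x → Reflects Y x → X ↔ Y
reflects-↔ (ofʸ x)  (ofʸ y)  = (λ _ → y) , (λ _ → x)
reflects-↔ (ofⁿ ¬x) (ofⁿ ¬y) = (λ x → ⊥-elim (¬x x)) , (λ y → ⊥-elim (¬y y))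

↔-reflects-≡ : ∀ {x y} → X ↔ Y → Reflects X x → Reflects Y y → x ≡ y
↔-reflects-≡ _       (ofʸ _)  (ofʸ _)  = refl
↔-reflects-≡ (f , _) (ofʸ x)  (ofⁿ ¬y) = ⊥-elim (¬y (f x))
↔-reflects-≡ (_ , g) (ofⁿ ¬x) (ofʸ y)  = ⊥-elim (¬x (g y))
↔-reflects-≡ _       (ofⁿ _)  (ofⁿ _)  = refl

piece : Valuation → Form → Form
piece b α = if b (C α) then signed (value b α) α ∧' C α else ¬' (C α)

C-piece : ∀ b α → ⊢ C (piece b α)
C-piece b α with b (C α)
... | true  = C-signed (value b α)
... | false = C-¬ C-C

value-piece : ∀ b b′ α → value b′ (piece b α) ≡ true →
              b′ (C α) ≡ b (C α) × (b (C α) ≡ true → value b′ α ≡ value b α)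
value-piece b b′ α t with b (C α)
... | true  = let (tα , tC) = value-∧ b′ (signed (value b α) α) (C α) t in
              tC , λ _ → proj₁ (value-signed b′ (value b α)) tα
... | false = not-injective t , λ ()

module Canonical (φ : Form) (b : Valuation) where

  c : Form → Bool
  c α = b (C α)

  Model : SDModel
  Model u = ∀ {α} → α ∈ boxes φ → c α ≡ true → eval u c α ≡ value b α

  reference : Model (λ p → b (var p))
  reference _ _ = refl

  model? : ∀ u → Dec (Model u)
  model? u = map′ All.lookup All.tabulate
    (All.all? (λ α → c α ≟ᵇ true →-dec eval u c α ≟ᵇ value b α) (boxes φ))

  Constant : Form → Set
  Constant ψ = ∀ u → Model u → eval u c ψ ≡ value b ψ

  constant? : ∀ ψ → Dec (Constant ψ)
  constant? ψ = ∀-assignment? (bound (φ ⇒ ψ)) (λ u → model? u →-dec eval u c ψ ≟ᵇ value b ψ) invariant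
    where
    agree : ∀ {u v} → u ≈[ bound (φ ⇒ ψ) ] v → ∀ χ → atoms χ ⊆ atoms (φ ⇒ ψ) → eval u c χ ≡ eval v c χ
    agree u≈v χ s = eval-cong χ (λ m → u≈v (var∈atoms⇒<bound (φ ⇒ ψ) (s m))) (λ _ → refl)
    invariant : ∀ {u v} → u ≈[ bound (φ ⇒ ψ) ] v →
                (Model u → eval u c ψ ≡ value b ψ) → Model v → eval v c ψ ≡ value b ψ
    invariant u≈v h v∈ = trans (sym (agree u≈v ψ (λ m → ∈-++⁺ʳ (atoms φ) m)))
      (h λ {α} α∈ t → trans (agree u≈v α (λ m → ∈-++⁺ˡ (∈boxes⇒atoms⊆ φ α∈ (there m)))) (v∈ α∈ t))

  truth : (∀ {ψ} → ψ ∈ boxes φ → Constant ψ → c ψ ≡ true) →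
          ∀ χ → boxes χ ⊆ boxes φ → ∀ {u} → Model u → Reflects (Model , u ⊨ χ) (eval u c χ)
  truth H (var p) s {u} _ = ≡true-reflects (u p)
  truth H (¬' χ) s u∈ = ¬-reflects (truth H χ s u∈)
  truth H (χ ⇒ ψ) s u∈ =
    truth H χ (λ m → s (∈-++⁺ˡ m)) u∈ →-reflects truth H ψ (λ m → s (∈-++⁺ʳ (boxes χ) m)) u∈
  truth H (C ψ) s {u} _ with c ψ in eq
  ... | true  = ofʸ λ u₁ u₂ u₁∈ u₂∈ → reflects-↔ (at u₁∈) (at u₂∈)
    where
    at : ∀ {u} → Model u → Reflects (Model , u ⊨ ψ) (value b ψ)
    at u∈ = subst (Reflects _) (u∈ (s (here refl)) eq) (truth H ψ (λ m → s (there m)) u∈)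
  ... | false = ofⁿ λ h → case trans (sym eq) (H (s (here refl)) (constant h)) of λ ()
    where
    constant : Model , u ⊨ C ψ → Constant ψ
    constant h u′ u′∈ = ↔-reflects-≡ (h u′ _ u′∈ reference)
      (truth H ψ (λ m → s (there m)) u′∈) (truth H ψ (λ m → s (there m)) reference)

  dichotomy : (∃[ ψ ] ψ ∈ boxes φ × Constant ψ × c ψ ≡ false) ⊎
              (∀ {ψ} → ψ ∈ boxes φ → Constant ψ → c ψ ≡ true)
  dichotomy with any? (λ ψ → constant? ψ ×-dec c ψ ≟ᵇ false) (boxes φ)
  ... | yes some = inj₁ (find some)
  ... | no none  = inj₂ λ ψ∈ k → ¬-not λ e → none (lose ψ∈ (k , e))

  Θ : Form
  Θ = ⋀ (piece b) (boxes φ)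

  Θ-derivable : literals b (atoms φ) ⊢ Θ
  Θ-derivable = ⋀-intro (boxes φ) piece-derivable
    where
    piece-derivable : ∀ {α} → α ∈ boxes φ → literals b (atoms φ) ⊢ piece b α
    piece-derivable {α} α∈ with c α | kalmar {b} (C α) (∈boxes⇒atoms⊆ φ α∈)
    ... | true  | d = ∧-intro (kalmar α (λ m → ∈boxes⇒atoms⊆ φ α∈ (there m))) d
    ... | false | d = d

  Θ-decides : ∀ {ψ} → ψ ∈ boxes φ → Constant ψ → Tautology (Θ ⇒ signed (value b ψ) ψ)
  Θ-decides {ψ} ψ∈ const b′ with value b′ Θ in Θ-true
  ... | false = refl
  ... | true  = proj₂ (value-signed b′ (value b ψ)) (trans (relative ψ (∈boxes⇒boxes⊆ φ ψ∈)) (const u u∈))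
    where
    u : Assignment
    u p = b′ (var p)
    relative : ∀ χ → boxes χ ⊆ boxes φ → value b′ χ ≡ eval u c χ
    relative χ s = eval-cong χ (λ _ → refl)
      (λ m → proj₁ (value-piece b b′ _ (value-⋀ b′ (boxes φ) Θ-true (s m))))
    u∈ : Model u
    u∈ {α} α∈ t = trans (sym (relative α (∈boxes⇒boxes⊆ φ α∈)))
                        (proj₂ (value-piece b b′ α (value-⋀ b′ (boxes φ) Θ-true α∈)) t)

  refutation : ∀ {ψ} → ψ ∈ boxes φ → Constant ψ → c ψ ≡ false → ∀ χ → literals b (atoms φ) ⊢ χ
  refutation {ψ} ψ∈ const eq χ = mp Cψ (mp ¬Cψ (thm explosion))
    where
    Θ⇒Cψ : ⊢ Θ ⇒ C (signed (value b ψ) ψ)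
    Θ⇒Cψ = C-mp (C-⋀ (boxes φ) (C-piece b)) (necessitation (tautology⇒theorem (Θ-decides ψ∈ const)))
    Cψ : literals b (atoms φ) ⊢ C ψ
    Cψ = mp (mp Θ-derivable (thm Θ⇒Cψ)) (thm (C-unsigned (value b ψ)))
    ¬Cψ : literals b (atoms φ) ⊢ ¬' (C ψ)
    ¬Cψ = subst (λ v → literals b (atoms φ) ⊢ signed v (C ψ)) eq (kalmar (C ψ) (∈boxes⇒atoms⊆ φ ψ∈))

  derivable : Valid φ → literals b (atoms φ) ⊢ φ
  derivable valid with dichotomy
  ... | inj₁ (ψ , ψ∈ , const , eq) = refutation ψ∈ const eq φ
  ... | inj₂ H = subst (λ v → literals b (atoms φ) ⊢ signed v φ) true-at-reference (kalmar φ (λ m → m))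
    where
    true-at-reference : value b φ ≡ true
    true-at-reference = det (truth H φ (λ m → m) reference) (ofʸ (valid Model _ reference))

completeness : Valid φ → ⊢ φ
completeness {φ} valid = literals-elimination (atoms φ) λ b → Canonical.derivable φ b valid

proposition7p5 : (φ : Form) → ((⊢ φ) → Valid φ) × (Valid φ → (⊢ φ))
proposition7p5 φ = soundness , completeness
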